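{- The formula $\neg\neg\Box p\to\Box\neg\neg p$ is derivable in $\mathsf{CK}\oplus N_\Diamond\oplus I_{\Diamond\Box}$ but not in $\mathsf{FIK}$.
   Context: Formulas are built from a countably infinite set of propositional variables by $\varphi ::= p \mid \bot \mid \varphi\wedge\varphi \mid \varphi\vee\varphi \mid \varphi\to\varphi \mid \Box\varphi \mid \Diamond\varphi$; $\neg\varphi:=\varphi\to\bot$. For a set $\mathsf{Ax}$ of formulas, $\mathsf{CK}\oplus\mathsf{Ax}$ is the logic whose derivable formulas are generated by: substitution instances of axioms of a standard Hilbert axiomatisation of intuitionistic propositional logic, of $\Box(p\to q)\to(\Box p\to\Box q)$, of $\Box(p\to q)\to(\Diamond p\to\Diamond q)$, and of formulas in $\mathsf{Ax}$; modus ponens; necessitation (from $\varphi$ infer $\Box\varphi$). $\mathsf{CK}\oplus A_1\oplus\dots\oplus A_n$ denotes $\mathsf{CK}\oplus\{A_1,\dots,A_n\}$. Axioms: $N_\Diamond$: $\Diamond\bot\to\bot$; $C_\Diamond$: $\Diamond(p\vee q)\to\Diamond p\vee\Diamond q$; $I_{\Diamond\Box}$: $(\Diamond p\to\Box q)\to\Box(p\to q)$; $\mathsf{wCD}$: $\Box(p\vee q)\to((\Diamond p\to\Box q)\to\Box q)$. $\mathsf{FIK}$ is $\mathsf{CK}\oplus N_\Diamond\oplus C_\Diamond\oplus\mathsf{wCD}$ (the logic obtained from $\mathsf{IK}=\mathsf{CK}\oplus N_\Diamond\oplus C_\Diamond\oplus I_{\Diamond\Box}$ by replacing $I_{\Diamond\Box}$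 with $\mathsf{wCD}$). -}

module Defs where

open import Data.Nat using (ℕ)
open import Data.List using (List; []; _∷_)
open import Data.List.Membership.Propositional using (_∈_)

infixr 6 _∧_
infixr 5 _∨_
infixr 4 _⇒_

data Formula : Set where
  var : ℕ → Formula
  ⊥'  : Formula
  _∧_ : Formula → Formula → Formula
  _∨_ : Formula → Formula → Formula
  _⇒_ : Formula → Formula → Formula
  □   : Formula → Formula
  ◇   : Formula → Formula

¬' : Formula → Formula
¬' φ = φ ⇒ ⊥'

Subst : Set
Subst = ℕ → Formula

sub : Subst → Formula → Formula
sub σ (var n) = σ n
sub σ ⊥' = ⊥'
sub σ (φ ∧ ψ) = sub σ φ ∧ sub σ ψ
sub σ (φ ∨ ψ) = sub σ φ ∨ sub σ ψ
sub σ (φ ⇒ ψ) = sub σ φ ⇒ sub σ ψ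
sub σ (□ φ) = □ (sub σ φ)
sub σ (◇ φ) = ◇ (sub σ φ)

p q r : Formula
p = var 0
q = var 1
r = var 2

-- A standard Hilbert axiomatisation of intuitionistic propositional logic
-- (axioms as formulas in the variables p, q, r; instances via substitution).
data IPCAxiom : Formula → Set where
  ipc1 : IPCAxiom (p ⇒ (q ⇒ p))
  ipc2 : IPCAxiom ((p ⇒ (q ⇒ r)) ⇒ ((p ⇒ q) ⇒ (p ⇒ r)))
  ipc3 : IPCAxiom (p ∧ q ⇒ p)
  ipc4 : IPCAxiom (p ∧ q ⇒ q)
  ipc5 : IPCAxiom (p ⇒ (q ⇒ p ∧ q))
  ipc6 : IPCAxiom (p ⇒ p ∨ q)
  ipc7 : IPCAxiom (q ⇒ p ∨ q)
  ipc8 : IPCAxiom ((p ⇒ r) ⇒ ((q ⇒ r) ⇒ (p ∨ q ⇒ r)))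
  ipc9 : IPCAxiom (⊥' ⇒ p)

K□ : Formula
K□ = □ (p ⇒ q) ⇒ (□ p ⇒ □ q)

K◇ : Formula
K◇ = □ (p ⇒ q) ⇒ (◇ p ⇒ ◇ q)

N◇ : Formula
N◇ = ◇ ⊥' ⇒ ⊥'

C◇ : Formula
C◇ = ◇ (p ∨ q) ⇒ (◇ p ∨ ◇ q)

I◇□ : Formula
I◇□ = (◇ p ⇒ □ q) ⇒ □ (p ⇒ q)

wCD : Formula
wCD = □ (p ∨ q) ⇒ ((◇ p ⇒ □ q) ⇒ □ q)

data CK⊕_⊢_ (Ax : List Formula) : Formula → Set where
  ipc  : ∀ {φ} → IPCAxiom φ → (σ : Subst) → CK⊕ Ax ⊢ sub σ φ
  k□   : (σ : Subst) → CK⊕ Ax ⊢ sub σ K□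
  k◇   : (σ : Subst) → CK⊕ Ax ⊢ sub σ K◇
  ax   : ∀ {φ} → φ ∈ Ax → (σ : Subst) → CK⊕ Ax ⊢ sub σ φ
  mp   : ∀ {φ ψ} → CK⊕ Ax ⊢ (φ ⇒ ψ) → CK⊕ Ax ⊢ φ → CK⊕ Ax ⊢ ψ
  nec  : ∀ {φ} → CK⊕ Ax ⊢ φ → CK⊕ Ax ⊢ □ φ

CK-N◇-I◇□ : List Formula
CK-N◇-I◇□ = N◇ ∷ I◇□ ∷ []

FIK : List Formula
FIK = N◇ ∷ C◇ ∷ wCD ∷ []

-- Derivability: instantiate I◇□ with p := ¬φ and q := ⊥.  Its premise ◇¬φ → □⊥ holds under
-- ¬¬□φ, because □φ gives □¬¬φ, which by K◇ turns ◇¬φ into ◇⊥, refuted by N◇.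
--
-- Underivability: FIK is sound for forward-confluent birelational models.  In the model
-- with worlds w, u, v, v', x, where w ≼ u, v ≼ v', v ≼ x, w R v, u R x, and p true only
-- at x, the world u forces □p, so ¬¬□p holds at w; but w R v ≼ v' and v' forces ¬p, so w
-- does not force □¬¬p.
module Submission where

open import Defs
open import Data.Empty using (⊥)
open import Data.List using (List; []; _∷_)
open import Data.List.Membership.Propositional using (_∈_)
open import Data.List.Relation.Unary.Any using (here; there)
open import Data.Nat using (ℕ; zero; suc)
open import Data.Product using (_×_; _,_; proj₁; proj₂; ∃-syntax)
open import Data.Sum using (_⊎_; inj₁; inj₂)
open import Relation.Binary.PropositionalEquality using (_≡_; refl)
open import Relation.Nullary using (¬_)

subst₃ : Formula → Formula → Formula → Subst
subst₃ A B C zero          = A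
subst₃ A B C (suc zero)    = B
subst₃ A B C (suc (suc _)) = C

module Deduction (Ax : List Formula) where

  infixl 9 _·_
  infix  3 _⊢_

  data _⊢_ (Γ : List Formula) : Formula → Set where
    hyp : ∀ {φ} → φ ∈ Γ → Γ ⊢ φ
    thm : ∀ {φ} → CK⊕ Ax ⊢ φ → Γ ⊢ φ
    _·_ : ∀ {φ ψ} → Γ ⊢ φ ⇒ ψ → Γ ⊢ φ → Γ ⊢ ψ

  #0 : ∀ {Γ φ} → φ ∷ Γ ⊢ φ
  #0 = hyp (here refl)

  #1 : ∀ {Γ φ ψ} → ψ ∷ φ ∷ Γ ⊢ φ
  #1 = hyp (there (here refl))

  ⇒-const : ∀ A B → CK⊕ Ax ⊢ (A ⇒ B ⇒ A)
  ⇒-const A B = ipc ipc1 (subst₃ A B ⊥')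

  ⇒-dist : ∀ A B C → CK⊕ Ax ⊢ ((A ⇒ B ⇒ C) ⇒ (A ⇒ B) ⇒ A ⇒ C)
  ⇒-dist A B C = ipc ipc2 (subst₃ A B C)

  ⇒-refl : ∀ A → CK⊕ Ax ⊢ (A ⇒ A)
  ⇒-refl A = mp (mp (⇒-dist A (A ⇒ A) A) (⇒-const A (A ⇒ A))) (⇒-const A A)

  deduction : ∀ {Γ A B} → A ∷ Γ ⊢ B → Γ ⊢ A ⇒ B
  deduction {A = A} (hyp (here refl)) = thm (⇒-refl A)
  deduction {A = A} (hyp (there i))   = thm (⇒-const _ A) · hyp i
  deduction {A = A} (thm d)           = thm (mp (⇒-const _ A) d)
  deduction {A = A} (_·_ {φ} {ψ} d e) = thm (⇒-dist A φ ψ) · deduction d · deduction e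

  closed : ∀ {φ} → [] ⊢ φ → CK⊕ Ax ⊢ φ
  closed (hyp ())
  closed (thm d)   = d
  closed (d · e)   = mp (closed d) (closed e)

module _ {Ax : List Formula} where
  open Deduction Ax

  □-¬¬-intro : ∀ φ → CK⊕ Ax ⊢ (□ φ ⇒ □ (¬' (¬' φ)))
  □-¬¬-intro φ = mp (k□ (subst₃ φ (¬' (¬' φ)) ⊥')) (nec ¬¬-intro)
    where
    ¬¬-intro : CK⊕ Ax ⊢ (φ ⇒ ¬' (¬' φ))
    ¬¬-intro = closed (deduction (deduction (#0 · #1)))

  □-◇¬-inconsistent : N◇ ∈ Ax → ∀ φ → CK⊕ Ax ⊢ (□ φ ⇒ ◇ (¬' φ) ⇒ ⊥')
  □-◇¬-inconsistent N◇∈Ax φ = closed (deduction (deduction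
    (thm N◇-inst · (thm (k◇ (subst₃ (¬' φ) ⊥' ⊥')) · (thm (□-¬¬-intro φ) · #1) · #0))))
    where
    N◇-inst : CK⊕ Ax ⊢ (◇ ⊥' ⇒ ⊥')
    N◇-inst = ax N◇∈Ax (subst₃ ⊥' ⊥' ⊥')

  ¬¬□⇒□¬¬ : N◇ ∈ Ax → I◇□ ∈ Ax → ∀ φ → CK⊕ Ax ⊢ (¬' (¬' (□ φ)) ⇒ □ (¬' (¬' φ)))
  ¬¬□⇒□¬¬ N◇∈Ax I◇□∈Ax φ = closed (deduction (thm I◇□-inst · deduction
    (thm ex-falso · (#1 · deduction (thm (□-◇¬-inconsistent N◇∈Ax φ) · #0 · #1)))))
    where
    I◇□-inst : CK⊕ Ax ⊢ ((◇ (¬' φ) ⇒ □ ⊥') ⇒ □ (¬' (¬' φ)))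
    I◇□-inst = ax I◇□∈Ax (subst₃ (¬' φ) ⊥' ⊥')
    ex-falso : CK⊕ Ax ⊢ (⊥' ⇒ □ ⊥')
    ex-falso = ipc ipc9 (subst₃ (□ ⊥') ⊥' ⊥')

record ForwardConfluentModel : Set₁ where
  infix 4 _≼_
  field
    World     : Set
    _≼_       : World → World → Set
    R         : World → World → Set
    ≼-refl    : ∀ {a} → a ≼ a
    ≼-trans   : ∀ {a b c} → a ≼ b → b ≼ c → a ≼ c
    V         : ℕ → World → Set
    V-mono    : ∀ n {a b} → a ≼ b → V n a → V n b
    confluent : ∀ {a b c} → a ≼ b → R a c → ∃[ d ] R b d × c ≼ d

module Forcing (M : ForwardConfluentModel) where
  open ForwardConfluentModel M

  infix 3 _⊩_

  -- ◇ does not quantify over ≼-successors; forward confluence is what keeps it monotone.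
  _⊩_ : World → Formula → Set
  a ⊩ var n   = V n a
  a ⊩ ⊥'      = ⊥
  a ⊩ φ ∧ ψ   = a ⊩ φ × a ⊩ ψ
  a ⊩ φ ∨ ψ   = a ⊩ φ ⊎ a ⊩ ψ
  a ⊩ φ ⇒ ψ   = ∀ b → a ≼ b → b ⊩ φ → b ⊩ ψ
  a ⊩ □ φ     = ∀ b → a ≼ b → ∀ c → R b c → c ⊩ φ
  a ⊩ ◇ φ     = ∃[ c ] R a c × c ⊩ φ

  Valid : Formula → Set
  Valid φ = ∀ a → a ⊩ φ

  ⊩-mono : ∀ φ {a b} → a ≼ b → a ⊩ φ → b ⊩ φ
  ⊩-mono (var n) a≼b h             = V-mono n a≼b h
  ⊩-mono ⊥'      a≼b ()
  ⊩-mono (φ ∧ ψ) a≼b (h , k)       = ⊩-mono φ a≼b h , ⊩-mono ψ a≼b k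
  ⊩-mono (φ ∨ ψ) a≼b (inj₁ h)      = inj₁ (⊩-mono φ a≼b h)
  ⊩-mono (φ ∨ ψ) a≼b (inj₂ h)      = inj₂ (⊩-mono ψ a≼b h)
  ⊩-mono (φ ⇒ ψ) a≼b f             = λ c b≼c → f c (≼-trans a≼b b≼c)
  ⊩-mono (□ φ)   a≼b f             = λ c b≼c → f c (≼-trans a≼b b≼c)
  ⊩-mono (◇ φ)   a≼b (c , aRc , h) with confluent a≼b aRc
  ... | d , bRd , c≼d = d , bRd , ⊩-mono φ c≼d h

  ipc-valid : ∀ {φ} → IPCAxiom φ → ∀ σ → Valid (sub σ φ)
  ipc-valid ipc1 σ _ = λ _ _ A c b≼c _ → ⊩-mono (σ 0) b≼c A
  ipc-valid ipc2 σ _ = λ _ _ f c b≼c g d c≼d A → f d (≼-trans b≼c c≼d) A d ≼-refl (g d c≼d A)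
  ipc-valid ipc3 σ _ = λ _ _ → proj₁
  ipc-valid ipc4 σ _ = λ _ _ → proj₂
  ipc-valid ipc5 σ _ = λ _ _ A c b≼c B → ⊩-mono (σ 0) b≼c A , B
  ipc-valid ipc6 σ _ = λ _ _ → inj₁
  ipc-valid ipc7 σ _ = λ _ _ → inj₂
  ipc-valid ipc8 σ _ = λ { _ _ f c b≼c g d c≼d (inj₁ A) → f d (≼-trans b≼c c≼d) A
                         ; _ _ f c b≼c g d c≼d (inj₂ B) → g d c≼d B }
  ipc-valid ipc9 σ _ = λ _ _ ()

  K□-valid : ∀ σ → Valid (sub σ K□)
  K□-valid σ _ _ _ f c b≼c g d c≼d y dRy =
    f d (≼-trans b≼c c≼d) y dRy y ≼-refl (g d c≼d y dRy)

  K◇-valid : ∀ σ → Valid (sub σ K◇)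
  K◇-valid σ _ _ _ f c b≼c (y , cRy , A) = y , cRy , f c b≼c y cRy y ≼-refl A

  N◇-valid : ∀ σ → Valid (sub σ N◇)
  N◇-valid σ _ _ _ ()

  C◇-valid : ∀ σ → Valid (sub σ C◇)
  C◇-valid σ _ _ _ (y , bRy , inj₁ A) = inj₁ (y , bRy , A)
  C◇-valid σ _ _ _ (y , bRy , inj₂ B) = inj₂ (y , bRy , B)

  wCD-valid : ∀ σ → Valid (sub σ wCD)
  wCD-valid σ _ b _ □A∨B c b≼c ◇A⇒□B d c≼d y dRy
    with □A∨B d (≼-trans b≼c c≼d) y dRy
  ... | inj₁ A = ◇A⇒□B d c≼d (y , dRy , A) d ≼-refl y dRy
  ... | inj₂ B = B

  soundness : ∀ {Ax} → (∀ {φ} → φ ∈ Ax → ∀ σ → Valid (sub σ φ)) →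
              ∀ {φ} → CK⊕ Ax ⊢ φ → Valid φ
  soundness Ax-valid (ipc A σ)   = ipc-valid A σ
  soundness Ax-valid (k□ σ)      = K□-valid σ
  soundness Ax-valid (k◇ σ)      = K◇-valid σ
  soundness Ax-valid (ax φ∈Ax σ) = Ax-valid φ∈Ax σ
  soundness Ax-valid (mp d e) a  = soundness Ax-valid d a a ≼-refl (soundness Ax-valid e a)
  soundness Ax-valid (nec d) _   = λ _ _ c _ → soundness Ax-valid d c

  FIK-valid : ∀ {φ} → φ ∈ FIK → ∀ σ → Valid (sub σ φ)
  FIK-valid (here refl)                 = N◇-valid
  FIK-valid (there (here refl))         = C◇-valid
  FIK-valid (there (there (here refl))) = wCD-valid

FIK-sound : ∀ {φ} → CK⊕ FIK ⊢ φ → (M : ForwardConfluentModel) → Forcing.Valid M φ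
FIK-sound d M = Forcing.soundness M (Forcing.FIK-valid M) d

module Countermodel where

  data World : Set where
    w u v v' x : World

  infix 4 _≼_

  data _≼_ : World → World → Set where
    ≼-refl : ∀ {a} → a ≼ a
    w≼u    : w ≼ u
    v≼v'   : v ≼ v'
    v≼x    : v ≼ x

  data R : World → World → Set where
    wRv : R w v
    uRx : R u x

  ≼-trans : ∀ {a b c} → a ≼ b → b ≼ c → a ≼ c
  ≼-trans ≼-refl b≼c    = b≼c
  ≼-trans w≼u    ≼-refl = w≼u
  ≼-trans v≼v'   ≼-refl = v≼v'
  ≼-trans v≼x    ≼-refl = v≼x

  V : ℕ → World → Set
  V _ a = a ≡ x

  V-mono : ∀ n {a b} → a ≼ b → V n a → V n b
  V-mono _ ≼-refl refl = refl

  confluent : ∀ {a b c} → a ≼ b → R a c → ∃[ d ] R b d × c ≼ d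
  confluent ≼-refl aRc = _ , aRc , ≼-refl
  confluent w≼u    wRv = x , uRx , v≼x

  model : ForwardConfluentModel
  model = record
    { World = World ; _≼_ = _≼_ ; R = R ; ≼-refl = ≼-refl ; ≼-trans = ≼-trans
    ; V = V ; V-mono = V-mono ; confluent = confluent }

  open Forcing model

  u⊩□p : u ⊩ □ p
  u⊩□p .u ≼-refl .x uRx = refl

  w⊩¬¬□p : w ⊩ ¬' (¬' (□ p))
  w⊩¬¬□p .w ≼-refl ¬□p = ¬□p u w≼u u⊩□p
  w⊩¬¬□p .u w≼u    ¬□p = ¬□p u ≼-refl u⊩□p

  v'⊩¬p : v' ⊩ ¬' p
  v'⊩¬p .v' ≼-refl ()

  w⊮□¬¬p : ¬ (w ⊩ □ (¬' (¬' p)))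
  w⊮□¬¬p w⊩□¬¬p = w⊩□¬¬p w ≼-refl v wRv v' v≼v' v'⊩¬p

¬¬□p⇒□¬¬p-not-FIK : ¬ (CK⊕ FIK ⊢ (¬' (¬' (□ p)) ⇒ □ (¬' (¬' p))))
¬¬□p⇒□¬¬p-not-FIK d = w⊮□¬¬p (FIK-sound d model w w ≼-refl w⊩¬¬□p)
  where open Countermodel

mainTheorem19 : (CK⊕ CK-N◇-I◇□ ⊢ (¬' (¬' (□ p)) ⇒ □ (¬' (¬' p)))) × (¬ (CK⊕ FIK ⊢ (¬' (¬' (□ p)) ⇒ □ (¬' (¬' p)))))
mainTheorem19 = ¬¬□⇒□¬¬ (here refl) (there (here refl)) p , ¬¬□p⇒□¬¬p-not-FIK
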